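{- Let $m\ge 2$ and let $G_0,\dots,G_{m-1}$ (indices in $\mathbb{Z}_m$) be $4$-graphs with vertex partitions $V(G_i)=V_i'\cup V_i''$. Suppose that for every $i\in\mathbb{Z}_m$ there is an integer $\alpha_i$ with $\alpha(G_i)=\alpha_i+1$, $\alpha(G_i\cap V_i')\le\alpha_i$ and $\alpha(G_i\cap V_i'')\le\alpha_i$. Let $A$ be an independent set in $C_m[G_0,\dots,G_{m-1}]$, and for $i\in\mathbb{Z}_m$ let $\chi_i=0$ if $A\cap W_i=\emptyset$ and $\chi_i=1$ otherwise. Then $|A|\le\sum_{i\in\mathbb{Z}_m}(\alpha_i-1+\chi_i)$.
   Context: A $4$-graph has a finite vertex set and edges which are $4$-element vertex subsets; a vertex set is independent if it contains no edge; $\alpha(\cdot)$ is the maximum size of an independent set; $G\cap U$ denotes the subgraph of $G$ induced by $U$. Circular construction: given $4$-graphs $G_i$, $i\in\mathbb{Z}_m$ ($m\ge2$), with $V(G_i)=V_i'\cup V_i''$ (disjoint), let $W_i=V_i'\times V_{i+1}''$ (the sets $W_i$ regarded as pairwise disjoint), and for $x\in V_i'$ let $W_{i,x}=\{(x,y):y\in V_{i+1}''\}$. For $A\subseteq\bigcup_i W_i$, $\beta_i(A)$ is the number of $x\in V_i'$ with $W_{i,x}\cap A\neq\emptyset$. Define $h_i:W_i\cup W_{i+1}\to V(G_{i+1})$ by $h_i((x,y))=y\in V_{i+1}''$ if $(x,y)\in W_i$ and $h_i((x,y))=x\in V_{i+1}'$ if $(x,y)\in W_{i+1}$. Let $E_i^1$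 be the set of $4$-sets $\{w_1,\dots,w_4\}\subseteq W_i\cup W_{i+1}$ with $\beta_i(\{w_1,\dots,w_4\})=1$ such that $h_i(w_1),\dots,h_i(w_4)$ form an edge of $G_{i+1}$. Let $E_i^2$ be the set of $4$-sets $\{w_1,\dots,w_4\}\subseteq W_i$, $w_j=(x_j,y_j)$, with $x_1=x_2$ and $x_3=x_4\ne x_1$. Let $E_i^4$ be the set of $4$-sets $\{w_1,\dots,w_4\}\subseteq W_i$, $w_j=(x_j,y_j)$, with $x_1,\dots,x_4$ pairwise distinct forming an edge of $G_i$. Then $C_m[G_0,\dots,G_{m-1}]$ is the $4$-graph with vertex set $\bigcup_{i\in\mathbb{Z}_m}W_i$ and edge set $\bigcup_{i\in\mathbb{Z}_m}(E_i^1\cup E_i^2\cup E_i^4)$. -}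

module Defs where

open import Data.Nat as ℕ using (ℕ; zero; suc; NonZero)
open import Data.Nat.DivMod using (_%_; m%n<n)
open import Data.Fin using (Fin; toℕ; fromℕ<)
open import Data.Fin.Properties using (_≟_)
open import Data.Fin.Subset using (Subset; ⁅_⁆; _∪_; ∣_∣; _⊆_; _∈_; _∉_; ∁)
open import Data.Integer as ℤ using (ℤ; +_)
open import Data.List using (List; []; _∷_; map; foldr; allFin)
open import Data.Bool.ListAction using (any)
open import Data.List.Relation.Unary.All using (All)
open import Data.List.Membership.Propositional as L using ()
open import Data.Vec using (tabulate)
open import Data.Bool using (Bool; true; false; if_then_else_)
open import Data.Product using (Σ; ∃; ∃-syntax; _×_; _,_)
open import Relation.Nullary using (¬_; yes; no; isYes)
open import Relation.Binary.PropositionalEquality using (_≡_; _≢_; refl)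
open import Data.Nat.ListAction using (sum)
open import Data.Sum using (_⊎_)

record FourGraph (n : ℕ) : Set where
  field
    edges   : List (Subset n)
    uniform : All (λ e → ∣ e ∣ ≡ 4) edges
open FourGraph public

Independent : ∀ {n} → FourGraph n → Subset n → Set
Independent G A = ∀ e → e L.∈ edges G → ¬ (e ⊆ A)

IndepNumberIs : ∀ {n} → FourGraph n → ℤ → Set
IndepNumberIs G k =
  (∃[ A ] (Independent G A × (+ ∣ A ∣ ≡ k))) ×
  (∀ A → Independent G A → + ∣ A ∣ ℤ.≤ k)

-- α(G ∩ U) ≤ k.  The independent sets of the induced subgraph G ∩ U are
-- exactly the independent sets of G contained in U.
InducedIndepAtMost : ∀ {n} → FourGraph n → Subset n → ℤ → Set
InducedIndepAtMost G U k = ∀ A → A ⊆ U → Independent G A → + ∣ A ∣ ℤ.≤ k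

next : ∀ {m} → Fin m → Fin m
next {suc k} i = fromℕ< (m%n<n (suc (toℕ i)) (suc k))

sumℕ : ∀ {m} → (Fin m → ℕ) → ℕ
sumℕ {m} f = sum (map f (allFin m))

sumℤ : ∀ {m} → (Fin m → ℤ) → ℤ
sumℤ {m} f = foldr ℤ._+_ (+ 0) (map f (allFin m))

module Circular (m : ℕ) (n : Fin m → ℕ)
                (G : (i : Fin m) → FourGraph (n i))
                (V′ : (i : Fin m) → Subset (n i)) where
  -- V_i'' is the complement ∁ (V′ i).

  -- Candidate vertices: triples (i , x , y) with x ∈ V(G_i), y ∈ V(G_{i+1}).
  -- Actual vertex (element of W_i) iff x ∈ V_i' and y ∈ V_{i+1}''.
  Vtx : Set
  Vtx = Σ (Fin m) (λ i → Fin (n i) × Fin (n (next i)))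

  InW : Vtx → Set
  InW (i , x , y) = (x ∈ V′ i) × (y ∉ V′ (next i))

  -- A set of vertices A ⊆ ⋃ W_i, given by A i x = A ∩ W_{i,x} (as a set of y's).
  VSet : Set
  VSet = (i : Fin m) → (x : Fin (n i)) → Subset (n (next i))

  _∈A_ : Vtx → VSet → Set
  (i , x , y) ∈A A = y ∈ A i x

  InUnionW : VSet → Set
  InUnionW A = ∀ i x y → y ∈ A i x → InW (i , x , y)

  sizeW : VSet → Fin m → ℕ
  sizeW A i = sumℕ (λ x → ∣ A i x ∣)

  size : VSet → ℕ
  size A = sumℕ (sizeW A)

  hit : Vtx → (i : Fin m) → Fin (n i) → Bool
  hit (k , x′ , y′) i x with k ≟ i
  ... | yes refl = isYes (x′ ≟ x)
  ... | no _     = false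

  β : Fin m → Vtx → Vtx → Vtx → Vtx → ℕ
  β i w₁ w₂ w₃ w₄ =
    ∣ tabulate (λ x → any (λ w → hit w i x) (w₁ ∷ w₂ ∷ w₃ ∷ w₄ ∷ [])) ∣

  -- h_i as a relation: h_i(w) = v ∈ V(G_{i+1})
  H : (i : Fin m) → Vtx → Fin (n (next i)) → Set
  H i w v = (∃[ x ] (w ≡ (i , x , v))) ⊎ (∃[ y ] (w ≡ (next i , v , y)))

  -- labelled versions of E_i^1, E_i^2, E_i^4; a 4-set is an edge of the
  -- given kind iff some labelling w_1,…,w_4 of it satisfies the condition.
  E¹ : Fin m → Vtx → Vtx → Vtx → Vtx → Set
  E¹ i w₁ w₂ w₃ w₄ =
    (β i w₁ w₂ w₃ w₄ ≡ 1) ×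
    ∃[ v₁ ] ∃[ v₂ ] ∃[ v₃ ] ∃[ v₄ ]
      (H i w₁ v₁ × H i w₂ v₂ × H i w₃ v₃ × H i w₄ v₄ ×
       ((⁅ v₁ ⁆ ∪ ⁅ v₂ ⁆ ∪ ⁅ v₃ ⁆ ∪ ⁅ v₄ ⁆) L.∈ edges (G (next i))))

  E² : Fin m → Vtx → Vtx → Vtx → Vtx → Set
  E² i w₁ w₂ w₃ w₄ =
    ∃[ x₁ ] ∃[ x₂ ] ∃[ x₃ ] ∃[ x₄ ] ∃[ y₁ ] ∃[ y₂ ] ∃[ y₃ ] ∃[ y₄ ]
      ((w₁ ≡ (i , x₁ , y₁)) × (w₂ ≡ (i , x₂ , y₂)) ×
       (w₃ ≡ (i , x₃ , y₃)) × (w₄ ≡ (i , x₄ , y₄)) ×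
       (x₁ ≡ x₂) × (x₃ ≡ x₄) × (x₃ ≢ x₁))

  E⁴ : Fin m → Vtx → Vtx → Vtx → Vtx → Set
  E⁴ i w₁ w₂ w₃ w₄ =
    ∃[ x₁ ] ∃[ x₂ ] ∃[ x₃ ] ∃[ x₄ ] ∃[ y₁ ] ∃[ y₂ ] ∃[ y₃ ] ∃[ y₄ ]
      ((w₁ ≡ (i , x₁ , y₁)) × (w₂ ≡ (i , x₂ , y₂)) ×
       (w₃ ≡ (i , x₃ , y₃)) × (w₄ ≡ (i , x₄ , y₄)) ×
       (x₁ ≢ x₂) × (x₁ ≢ x₃) × (x₁ ≢ x₄) ×
       (x₂ ≢ x₃) × (x₂ ≢ x₄) × (x₃ ≢ x₄) ×
       ((⁅ x₁ ⁆ ∪ ⁅ x₂ ⁆ ∪ ⁅ x₃ ⁆ ∪ ⁅ x₄ ⁆) L.∈ edges (G i)))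

  IndependentC : VSet → Set
  IndependentC A =
    ∀ (w₁ w₂ w₃ w₄ : Vtx) →
      w₁ ∈A A → w₂ ∈A A → w₃ ∈A A → w₄ ∈A A →
      w₁ ≢ w₂ → w₁ ≢ w₃ → w₁ ≢ w₄ → w₂ ≢ w₃ → w₂ ≢ w₄ → w₃ ≢ w₄ →
      ∀ i → ¬ (E¹ i w₁ w₂ w₃ w₄) × ¬ (E² i w₁ w₂ w₃ w₄) × ¬ (E⁴ i w₁ w₂ w₃ w₄)

  χ : VSet → Fin m → ℤ
  χ A i with sizeW A i
  ... | zero  = + 0
  ... | suc _ = + 1

-- For i ∈ ℤ_m let X_i ⊆ V_i' be the set of x with A ∩ W_{i,x} ≠ ∅, so |X_i| = β_i(A), and
-- s_i = |A ∩ W_i|.  The edges E⁴ make X_i independent in G_i, so |X_i| ≤ α_i.  The edges E²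
-- allow at most one column W_{i,c} to meet A twice, so s_i ≤ |X_i| + |A ∩ W_{i,c}| − 1.  The
-- edges E¹ make (A ∩ W_{i,c}) ∪ X_{i+1} independent in G_{i+1} (reading A ∩ W_{i,c} inside
-- V_{i+1}''), so |A ∩ W_{i,c}| + |X_{i+1}| ≤ α_{i+1} + χ_{i+1}.  Hence
--   s_i + |X_{i+1}| ≤ (α_{i+1} − 1 + χ_{i+1}) + |X_i|,
-- also when A ∩ W_i = ∅ since α_{i+1} ≥ 1, and summing around the cycle the |X_i| cancel.

module Submission where

open import Defs

module Counting where

  open import Algebra.Properties.CommutativeMonoid.Sum as ∑ using ()
  open import Data.Bool using (Bool; true; false; T)
  open import Data.Bool.ListAction using (any)
  open import Data.Empty using (⊥-elim)
  open import Data.Fin using (Fin; zero; suc; toℕ; fromℕ; inject₁; punchIn)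
  open import Data.Fin.Properties
    using (_≟_; any?; toℕ-injective; toℕ-fromℕ<; toℕ-fromℕ; toℕ-inject₁; toℕ<n; punchInᵢ≢i; 0≢1+n)
  open import Data.Fin.Subset
    using (Subset; ⁅_⁆; _∪_; ∣_∣; _⊆_; _∈_; _∉_; ∁; ⊥; Nonempty)
  open import Data.Fin.Subset.Properties
    using (_∈?_; nonempty?; Empty-unique; ∣⊥∣≡0; x∈⁅x⁆; x∈⁅y⁆⇒x≡y; ∣⁅x⁆∣≡1; p⊆q⇒∣p∣≤∣q∣;
           ⊆-antisym; ⊥⊆; x∈p∪q⁻; x∉p⇒x∈∁p; ∪-identityˡ; ∪-identityʳ; drop-there; p⊆p∪q; q⊆p∪q)
  open import Data.Integer as ℤ using (ℤ; -[1+_])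
  open import Data.Integer.Properties using (drop‿+≤+; +-injective)
  open import Data.List as List using (List; []; _∷_; allFin)
  open import Data.List.Properties using (map-tabulate)
  import Data.List.Membership.Propositional as L
  open import Data.List.Relation.Unary.All as All using (All; []; _∷_; lookupAny)
  open import Data.List.Relation.Unary.Any as Any using (Any; here; there)
  open import Data.List.Relation.Unary.Any.Properties using (any⁺; any⁻)
  open import Data.Nat using (ℕ; zero; suc; pred; _+_; _<ᵇ_; _<?_; _≤_; _<_; z≤n; s≤s; z<s)
  open import Data.Nat.DivMod using (_%_; n%n≡0; m<n⇒m%n≡m)
  open import Data.Nat.ListAction as ℕᴸ using ()
  open import Data.Nat.Properties
    using (+-0-commutativeMonoid; +-commutativeSemigroup; +-comm; +-assoc; +-suc; suc-injective;
           +-mono-≤; +-monoˡ-≤; +-monoʳ-≤; +-cancelʳ-≤; m≤m+n; ≤-trans; ≤-reflexive; <-trans;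
           >⇒≢; <⇒≱; ≮⇒≥; <ᵇ⇒<; 1+n≢n; module ≤-Reasoning)
  open import Data.Product using (∃₂; ∃-syntax; _×_; _,_; proj₁; proj₂)
  open import Data.Sum using (_⊎_; inj₁; inj₂)
  open import Data.Vec using ([]; _∷_; here; there; tabulate)
  open import Data.Vec.Properties using (lookup∘tabulate; []=⇒lookup; lookup⇒[]=)
  open import Function using (_∘_; id)
  open import Relation.Nullary using (¬_; ¬?; Dec; yes; no; isYes; contradiction; _×-dec_)
  open import Relation.Nullary.Decidable using (decidable-stable; toWitness; fromWitness)
  open import Relation.Binary.PropositionalEquality

  open import Algebra.Properties.CommutativeSemigroup +-commutativeSemigroup using (xy∙z≈xz∙y)
  open ∑ +-0-commutativeMonoid using (sum; sum-cong-≗; ∑-distrib-+; sum-init-last; sum-remove)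

  -- Finite sums over Fin

  sum-mono-≤ : ∀ {n} {f g : Fin n → ℕ} → (∀ i → f i ≤ g i) → sum f ≤ sum g
  sum-mono-≤ {zero}  f≤g = z≤n
  sum-mono-≤ {suc n} f≤g = +-mono-≤ (f≤g zero) (sum-mono-≤ (f≤g ∘ suc))

  sum-positive : ∀ {n} (f : Fin n → ℕ) → 0 < sum f → ∃[ i ] 0 < f i
  sum-positive {suc n} f 0<Σf with f zero in f₀≡
  ... | suc _ = zero , ≤-trans (s≤s z≤n) (≤-reflexive (sym f₀≡))
  ... | zero  = let i , 0<fᵢ = sum-positive (f ∘ suc) 0<Σf in suc i , 0<fᵢ

  sumℕ≡sum : ∀ {n} (f : Fin n → ℕ) → sumℕ f ≡ sum f
  sumℕ≡sum f = trans (cong ℕᴸ.sum (map-tabulate id f)) (sum-tabulate f)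
    where
    sum-tabulate : ∀ {n} (f : Fin n → ℕ) → ℕᴸ.sum (List.tabulate f) ≡ sum f
    sum-tabulate {zero}  f = refl
    sum-tabulate {suc n} f = cong (f zero +_) (sum-tabulate (f ∘ suc))

  sumℤ≡+sumℕ : ∀ {n} {f : Fin n → ℤ} (g : Fin n → ℕ) → (∀ i → f i ≡ ℤ.+ g i) → sumℤ f ≡ ℤ.+ sumℕ g
  sumℤ≡+sumℕ {n} {f} g f≡g = go (allFin n)
    where
    go : ∀ is → List.foldr ℤ._+_ (ℤ.+ 0) (List.map f is) ≡ ℤ.+ ℕᴸ.sum (List.map g is)
    go []       = refl
    go (i ∷ is) = cong₂ ℤ._+_ (f≡g i) (go is)

  last-or-inject₁ : ∀ {n} (i : Fin (suc n)) → i ≡ fromℕ n ⊎ ∃[ j ] i ≡ inject₁ j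
  last-or-inject₁ {zero}  zero    = inj₁ refl
  last-or-inject₁ {suc n} zero    = inj₂ (zero , refl)
  last-or-inject₁ {suc n} (suc i) with last-or-inject₁ i
  ... | inj₁ refl       = inj₁ refl
  ... | inj₂ (j , refl) = inj₂ (suc j , refl)

  toℕ-next : ∀ {k} (i : Fin (suc k)) → toℕ (next i) ≡ suc (toℕ i) % suc k
  toℕ-next i = toℕ-fromℕ< _

  next-inject₁ : ∀ {k} (j : Fin k) → next (inject₁ j) ≡ suc j
  next-inject₁ {k} j = toℕ-injective (begin
    toℕ (next (inject₁ j))        ≡⟨ toℕ-next (inject₁ j) ⟩
    suc (toℕ (inject₁ j)) % suc k ≡⟨ cong (λ t → suc t % suc k) (toℕ-inject₁ j) ⟩
    suc (toℕ j) % suc k           ≡⟨ m<n⇒m%n≡m (s≤s (toℕ<n j)) ⟩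
    suc (toℕ j)                   ∎)
    where open ≡-Reasoning

  next-fromℕ : ∀ k → next (fromℕ k) ≡ zero
  next-fromℕ k = toℕ-injective (begin
    toℕ (next (fromℕ k))        ≡⟨ toℕ-next (fromℕ k) ⟩
    suc (toℕ (fromℕ k)) % suc k ≡⟨ cong (λ t → suc t % suc k) (toℕ-fromℕ k) ⟩
    suc k % suc k               ≡⟨ n%n≡0 (suc k) ⟩
    0                           ∎)
    where open ≡-Reasoning

  next≢id : ∀ {k} (i : Fin (2 + k)) → next i ≢ i
  next≢id {k} i with last-or-inject₁ i
  ... | inj₁ refl       = 0≢1+n ∘ trans (sym (next-fromℕ (suc k)))
  ... | inj₂ (j , refl) = λ eq →
    1+n≢n (trans (cong toℕ (trans (sym (next-inject₁ j)) eq)) (toℕ-inject₁ j))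

  sum-next : ∀ {k} (f : Fin (suc k) → ℕ) → sum (f ∘ next) ≡ sum f
  sum-next {k} f = begin
    sum (f ∘ next)                                 ≡⟨ sum-init-last (f ∘ next) ⟩
    sum (f ∘ next ∘ inject₁) + f (next (fromℕ k))  ≡⟨ cong₂ _+_ (sum-cong-≗ (cong f ∘ next-inject₁))
                                                               (cong f (next-fromℕ k)) ⟩
    sum (f ∘ suc) + f zero                         ≡⟨ +-comm _ (f zero) ⟩
    sum f                                          ∎
    where open ≡-Reasoning

  sum-≤-by-cyclic-step : ∀ {k} (s c b : Fin (suc k) → ℕ) →
    (∀ i → s i + b (next i) ≤ c (next i) + b i) → sum s ≤ sum c
  sum-≤-by-cyclic-step s c b step = +-cancelʳ-≤ (sum b) (sum s) (sum c) (begin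
    sum s + sum b                 ≡⟨ cong (sum s +_) (sum-next b) ⟨
    sum s + sum (b ∘ next)        ≡⟨ ∑-distrib-+ s (b ∘ next) ⟨
    sum (λ i → s i + b (next i))  ≤⟨ sum-mono-≤ step ⟩
    sum (λ i → c (next i) + b i)  ≡⟨ ∑-distrib-+ (c ∘ next) b ⟩
    sum (c ∘ next) + sum b        ≡⟨ cong (_+ sum b) (sum-next c) ⟩
    sum c + sum b                 ∎)
    where open ≤-Reasoning

  sgn : ℕ → ℕ
  sgn zero    = 0
  sgn (suc _) = 1

  sgn≤id : ∀ n → sgn n ≤ n
  sgn≤id zero    = z≤n
  sgn≤id (suc n) = s≤s z≤n

  ≤1⇒≤sgn : ∀ {n} → n ≤ 1 → n ≤ sgn n
  ≤1⇒≤sgn z≤n       = z≤n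
  ≤1⇒≤sgn (s≤s z≤n) = s≤s z≤n

  sum-≤-sum-sgn+pred : ∀ {n} (f : Fin n → ℕ) (c : Fin n) → (∀ x → x ≢ c → f x ≤ 1) →
    sum f ≤ sum (sgn ∘ f) + pred (f c)
  sum-≤-sum-sgn+pred {suc n} f c light = begin
    sum f
      ≡⟨ sum-remove f ⟩
    f c + sum (f ∘ punchIn c)
      ≤⟨ +-mono-≤ (≤-reflexive (n≡sgn+pred (f c))) (sum-mono-≤ λ j → ≤1⇒≤sgn (light _ (punchInᵢ≢i c j))) ⟩
    (sgn (f c) + pred (f c)) + sum (sgn ∘ f ∘ punchIn c)
      ≡⟨ xy∙z≈xz∙y (sgn (f c)) _ _ ⟩
    (sgn (f c) + sum (sgn ∘ f ∘ punchIn c)) + pred (f c)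
      ≡⟨ cong (_+ pred (f c)) (sum-remove (sgn ∘ f)) ⟨
    sum (sgn ∘ f) + pred (f c)
      ∎
    where
    open ≤-Reasoning
    n≡sgn+pred : ∀ n → n ≡ sgn n + pred n
    n≡sgn+pred zero    = refl
    n≡sgn+pred (suc n) = refl

  -- Subsets of Fin n

  ∣p∣>0⇒nonempty : ∀ {n} {p : Subset n} → 0 < ∣ p ∣ → Nonempty p
  ∣p∣>0⇒nonempty {n} {p} 0<∣p∣ with nonempty? p
  ... | yes p≠∅ = p≠∅
  ... | no  p=∅ = contradiction (trans (cong ∣_∣ (Empty-unique p=∅)) (∣⊥∣≡0 n)) (>⇒≢ 0<∣p∣)

  ∣p∣>1⇒∃≢ : ∀ {n} {p : Subset n} → 1 < ∣ p ∣ → ∀ x → ∃[ y ] y ∈ p × y ≢ x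
  ∣p∣>1⇒∃≢ {p = p} 1<∣p∣ x with any? (λ y → y ∈? p ×-dec ¬? (y ≟ x))
  ... | yes found = found
  ... | no  none  = contradiction (subst (∣ p ∣ ≤_) (∣⁅x⁆∣≡1 x) (p⊆q⇒∣p∣≤∣q∣ p⊆⁅x⁆)) (<⇒≱ 1<∣p∣)
    where
    p⊆⁅x⁆ : p ⊆ ⁅ x ⁆
    p⊆⁅x⁆ {y} y∈p =
      subst (_∈ ⁅ x ⁆) (sym (decidable-stable (y ≟ x) λ y≢x → none (y , y∈p , y≢x))) (x∈⁅x⁆ x)

  ∣p∣≡0⇒p≡⊥ : ∀ {n} (p : Subset n) → ∣ p ∣ ≡ 0 → p ≡ ⊥
  ∣p∣≡0⇒p≡⊥ []          _     = refl
  ∣p∣≡0⇒p≡⊥ (true ∷ p)  ()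
  ∣p∣≡0⇒p≡⊥ (false ∷ p) ∣p∣≡0 = cong (false ∷_) (∣p∣≡0⇒p≡⊥ p ∣p∣≡0)

  ∣p∣≡1+k⇒p≡⁅x⁆∪q : ∀ {n k} (p : Subset n) → ∣ p ∣ ≡ suc k →
    ∃₂ λ x q → x ∉ q × p ≡ ⁅ x ⁆ ∪ q × ∣ q ∣ ≡ k
  ∣p∣≡1+k⇒p≡⁅x⁆∪q (true ∷ p)  ∣p∣≡1+k =
    zero , false ∷ p , (λ ()) , cong (true ∷_) (sym (∪-identityˡ p)) , suc-injective ∣p∣≡1+k
  ∣p∣≡1+k⇒p≡⁅x⁆∪q (false ∷ p) ∣p∣≡1+k with ∣p∣≡1+k⇒p≡⁅x⁆∪q p ∣p∣≡1+k
  ... | x , q , x∉q , refl , ∣q∣≡k = suc x , false ∷ q , x∉q ∘ drop-there , refl , ∣q∣≡k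

  ∣p∣≡1⇒p≡⁅x⁆ : ∀ {n} (p : Subset n) → ∣ p ∣ ≡ 1 → ∃[ x ] p ≡ ⁅ x ⁆
  ∣p∣≡1⇒p≡⁅x⁆ p ∣p∣≡1 with ∣p∣≡1+k⇒p≡⁅x⁆∪q p ∣p∣≡1
  ... | x , q , _ , refl , ∣q∣≡0 =
    x , trans (cong (⁅ x ⁆ ∪_) (∣p∣≡0⇒p≡⊥ q ∣q∣≡0)) (∪-identityʳ ⁅ x ⁆)

  ∣p∪q∣≡∣p∣+∣q∣ : ∀ {n} (p q : Subset n) → (∀ {x} → x ∈ p → x ∉ q) → ∣ p ∪ q ∣ ≡ ∣ p ∣ + ∣ q ∣
  ∣p∪q∣≡∣p∣+∣q∣ []          []          _ = refl
  ∣p∪q∣≡∣p∣+∣q∣ (true ∷ p)  (true ∷ q)  d = contradiction here (d here)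
  ∣p∪q∣≡∣p∣+∣q∣ (true ∷ p)  (false ∷ q) d =
    cong suc (∣p∪q∣≡∣p∣+∣q∣ p q (λ x∈p → d (there x∈p) ∘ there))
  ∣p∪q∣≡∣p∣+∣q∣ (false ∷ p) (true ∷ q)  d =
    trans (cong suc (∣p∪q∣≡∣p∣+∣q∣ p q (λ x∈p → d (there x∈p) ∘ there))) (sym (+-suc ∣ p ∣ ∣ q ∣))
  ∣p∪q∣≡∣p∣+∣q∣ (false ∷ p) (false ∷ q) d =
    ∣p∪q∣≡∣p∣+∣q∣ p q (λ x∈p → d (there x∈p) ∘ there)

  ∈tabulate⇒T : ∀ {n} {f : Fin n → Bool} {x} → x ∈ tabulate f → T (f x)
  ∈tabulate⇒T {f = f} {x} x∈ = subst T (trans (sym ([]=⇒lookup x∈)) (lookup∘tabulate f x)) _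

  T⇒∈tabulate : ∀ {n} {f : Fin n → Bool} {x} → T (f x) → x ∈ tabulate f
  T⇒∈tabulate {f = f} {x} fx with f x in fx≡
  ... | true = lookup⇒[]= x (tabulate f) (trans (lookup∘tabulate f x) fx≡)

  ∣tabulate∣≡1 : ∀ {n} (f : Fin n → Bool) c → (∀ x → T (f x) → x ≡ c) → T (f c) → ∣ tabulate f ∣ ≡ 1
  ∣tabulate∣≡1 f c only-c fc = trans (cong ∣_∣ (⊆-antisym tab⊆⁅c⁆ ⁅c⁆⊆tab)) (∣⁅x⁆∣≡1 c)
    where
    tab⊆⁅c⁆ : tabulate f ⊆ ⁅ c ⁆
    tab⊆⁅c⁆ {x} x∈ = subst (_∈ ⁅ c ⁆) (sym (only-c x (∈tabulate⇒T x∈))) (x∈⁅x⁆ c)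
    ⁅c⁆⊆tab : ⁅ c ⁆ ⊆ tabulate f
    ⁅c⁆⊆tab {x} x∈ = subst (_∈ tabulate f) (sym (x∈⁅y⁆⇒x≡y c x∈)) (T⇒∈tabulate fc)

  ∣tabulate-any∣≡1 : ∀ {A : Set} {n} (h : A → Fin n → Bool) (ws : List A) c →
    All (λ w → ∀ x → T (h w x) → x ≡ c) ws → Any (λ w → T (h w c)) ws →
    ∣ tabulate (λ x → any (λ w → h w x) ws) ∣ ≡ 1
  ∣tabulate-any∣≡1 h ws c only-c hits-c = ∣tabulate∣≡1 _ c
    (λ x hx → let only , hits = lookupAny only-c (any⁻ _ ws hx) in only x hits)
    (any⁺ _ hits-c)

  ∣tabulate-0<ᵇ∣ : ∀ {n} (f : Fin n → ℕ) → ∣ tabulate (λ x → 0 <ᵇ f x) ∣ ≡ sum (sgn ∘ f)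
  ∣tabulate-0<ᵇ∣ {zero}  f = refl
  ∣tabulate-0<ᵇ∣ {suc n} f with f zero
  ... | zero  = ∣tabulate-0<ᵇ∣ (f ∘ suc)
  ... | suc _ = cong suc (∣tabulate-0<ᵇ∣ (f ∘ suc))

  ∈⁅x⁆∪ : ∀ {n} {x : Fin n} {p} → x ∈ ⁅ x ⁆ ∪ p
  ∈⁅x⁆∪ {x = x} = p⊆p∪q _ (x∈⁅x⁆ x)

  ∈∪ʳ : ∀ {n} {x : Fin n} {p q} → x ∈ q → x ∈ p ∪ q
  ∈∪ʳ = q⊆p∪q _ _

  -- 4-graphs

  ⁅_,_,_,_⁆₄ : ∀ {n} → Fin n → Fin n → Fin n → Fin n → Subset n
  ⁅ x₁ , x₂ , x₃ , x₄ ⁆₄ = ⁅ x₁ ⁆ ∪ ⁅ x₂ ⁆ ∪ ⁅ x₃ ⁆ ∪ ⁅ x₄ ⁆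

  record Distinct₄ {A : Set} (x₁ x₂ x₃ x₄ : A) : Set where
    constructor distinct₄
    field
      x₁≢x₂ : x₁ ≢ x₂
      x₁≢x₃ : x₁ ≢ x₃
      x₁≢x₄ : x₁ ≢ x₄
      x₂≢x₃ : x₂ ≢ x₃
      x₂≢x₄ : x₂ ≢ x₄
      x₃≢x₄ : x₃ ≢ x₄

  Distinct₄-reflect : ∀ {A B : Set} (R : A → B → Set) → (∀ {a b b′} → R a b → R a b′ → b ≡ b′) →
    ∀ {a₁ a₂ a₃ a₄ b₁ b₂ b₃ b₄} → R a₁ b₁ → R a₂ b₂ → R a₃ b₃ → R a₄ b₄ →
    Distinct₄ b₁ b₂ b₃ b₄ → Distinct₄ a₁ a₂ a₃ a₄
  Distinct₄-reflect R functional r₁ r₂ r₃ r₄ (distinct₄ d₁₂ d₁₃ d₁₄ d₂₃ d₂₄ d₃₄) =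
    distinct₄ (reflect r₁ r₂ d₁₂) (reflect r₁ r₃ d₁₃) (reflect r₁ r₄ d₁₄)
              (reflect r₂ r₃ d₂₃) (reflect r₂ r₄ d₂₄) (reflect r₃ r₄ d₃₄)
    where
    reflect : ∀ {a a′ b b′} → R a b → R a′ b′ → b ≢ b′ → a ≢ a′
    reflect r r′ b≢b′ refl = b≢b′ (functional r r′)

  ∣e∣≡4⇒e≡⁅x₁,x₂,x₃,x₄⁆₄ : ∀ {n} (e : Subset n) → ∣ e ∣ ≡ 4 →
    ∃₂ λ x₁ x₂ → ∃₂ λ x₃ x₄ → Distinct₄ x₁ x₂ x₃ x₄ × e ≡ ⁅ x₁ , x₂ , x₃ , x₄ ⁆₄
  ∣e∣≡4⇒e≡⁅x₁,x₂,x₃,x₄⁆₄ e ∣e∣≡4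
    with x₁ , e₁ , x₁∉e₁ , refl , ∣e₁∣≡3 ← ∣p∣≡1+k⇒p≡⁅x⁆∪q e ∣e∣≡4
    with x₂ , e₂ , x₂∉e₂ , refl , ∣e₂∣≡2 ← ∣p∣≡1+k⇒p≡⁅x⁆∪q e₁ ∣e₁∣≡3
    with x₃ , e₃ , x₃∉e₃ , refl , ∣e₃∣≡1 ← ∣p∣≡1+k⇒p≡⁅x⁆∪q e₂ ∣e₂∣≡2
    with x₄ , refl ← ∣p∣≡1⇒p≡⁅x⁆ e₃ ∣e₃∣≡1
    = x₁ , x₂ , x₃ , x₄ ,
      distinct₄ (∉⇒≢ x₁∉e₁ ∈⁅x⁆∪) (∉⇒≢ x₁∉e₁ (∈∪ʳ ∈⁅x⁆∪)) (∉⇒≢ x₁∉e₁ (∈∪ʳ (∈∪ʳ (x∈⁅x⁆ x₄))))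
                (∉⇒≢ x₂∉e₂ ∈⁅x⁆∪) (∉⇒≢ x₂∉e₂ (∈∪ʳ (x∈⁅x⁆ x₄))) (∉⇒≢ x₃∉e₃ (x∈⁅x⁆ x₄)) ,
      refl
    where
    ∉⇒≢ : ∀ {n} {x y : Fin n} {p} → x ∉ p → y ∈ p → x ≢ y
    ∉⇒≢ x∉p y∈p refl = x∉p y∈p

  SpansNoEdge : ∀ {n} → FourGraph n → Subset n → Set
  SpansNoEdge G B = ∀ {x₁ x₂ x₃ x₄} → x₁ ∈ B → x₂ ∈ B → x₃ ∈ B → x₄ ∈ B →
    Distinct₄ x₁ x₂ x₃ x₄ → ¬ (⁅ x₁ , x₂ , x₃ , x₄ ⁆₄ L.∈ edges G)

  spansNoEdge⇒independent : ∀ {n} {G : FourGraph n} {B} → SpansNoEdge G B → Independent G B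
  spansNoEdge⇒independent {G = G} noEdge e e∈G e⊆B
    with x₁ , x₂ , x₃ , x₄ , distinct , refl ← ∣e∣≡4⇒e≡⁅x₁,x₂,x₃,x₄⁆₄ e (All.lookup (uniform G) e∈G)
    = noEdge (e⊆B ∈⁅x⁆∪) (e⊆B (∈∪ʳ ∈⁅x⁆∪)) (e⊆B (∈∪ʳ (∈∪ʳ ∈⁅x⁆∪)))
             (e⊆B (∈∪ʳ (∈∪ʳ (∈∪ʳ (x∈⁅x⁆ x₄))))) distinct e∈G

  ∣B∣<4⇒independent : ∀ {n} (G : FourGraph n) {B} → ∣ B ∣ < 4 → Independent G B
  ∣B∣<4⇒independent G {B} ∣B∣<4 e e∈G e⊆B =
    <⇒≱ ∣B∣<4 (subst (_≤ ∣ B ∣) (All.lookup (uniform G) e∈G) (p⊆q⇒∣p∣≤∣q∣ e⊆B))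

  ⊆-independent : ∀ {n} {G : FourGraph n} {B C} → C ⊆ B → Independent G B → Independent G C
  ⊆-independent C⊆B B-indep e e∈G e⊆C = B-indep e e∈G (C⊆B ∘ e⊆C)

  sideBounds⇒1≤α : ∀ {n} {G : FourGraph n} {V′ α} →
    InducedIndepAtMost G V′ α → InducedIndepAtMost G (∁ V′) α → ∀ x → ℤ.+ 1 ℤ.≤ α
  sideBounds⇒1≤α {G = G} {V′} {α} bound′ bound″ x =
    subst (ℤ._≤ α) (cong ℤ.+_ (∣⁅x⁆∣≡1 x)) (bound-⁅x⁆ (x ∈? V′))
    where
    ⁅x⁆-indep : Independent G ⁅ x ⁆
    ⁅x⁆-indep = ∣B∣<4⇒independent G (subst (_< 4) (sym (∣⁅x⁆∣≡1 x)) (s≤s (s≤s z≤n)))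
    ⁅x⁆⊆ : ∀ {p} → x ∈ p → ⁅ x ⁆ ⊆ p
    ⁅x⁆⊆ {p} x∈p y∈⁅x⁆ = subst (_∈ p) (sym (x∈⁅y⁆⇒x≡y x y∈⁅x⁆)) x∈p
    bound-⁅x⁆ : Dec (x ∈ V′) → ℤ.+ ∣ ⁅ x ⁆ ∣ ℤ.≤ α
    bound-⁅x⁆ (yes x∈V′) = bound′ ⁅ x ⁆ (⁅x⁆⊆ x∈V′) ⁅x⁆-indep
    bound-⁅x⁆ (no  x∉V′) = bound″ ⁅ x ⁆ (⁅x⁆⊆ (x∉p⇒x∈∁p x∉V′)) ⁅x⁆-indep

  record SplitIndepBound {n} (G : FourGraph n) (V′ : Subset n) (a : ℕ) : Set where
    field
      whole : ∀ B → Independent G B → ∣ B ∣ ≤ 2 + a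
      in-V′ : ∀ B → B ⊆ V′ → Independent G B → ∣ B ∣ ≤ suc a
      in-V″ : ∀ B → B ⊆ ∁ V′ → Independent G B → ∣ B ∣ ≤ suc a

  -- α < 0 is refuted by B = ⊥, and α = 0 by a vertex of a maximum independent set (of size 1).
  splitIndepBound : ∀ {n} {G : FourGraph n} {V′} {α} →
    IndepNumberIs G (α ℤ.+ ℤ.+ 1) × InducedIndepAtMost G V′ α × InducedIndepAtMost G (∁ V′) α →
    ∃[ a ] α ≡ ℤ.+ suc a × SplitIndepBound G V′ a
  splitIndepBound {n} {G} {α = -[1+ k ]} (_ , bound′ , _)
    with () ← subst (ℤ._≤ -[1+ k ]) (cong ℤ.+_ (∣⊥∣≡0 n))
                (bound′ ⊥ ⊥⊆ (∣B∣<4⇒independent G (subst (_< 4) (sym (∣⊥∣≡0 n)) (s≤s z≤n))))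
  splitIndepBound {G = G} {α = ℤ.+ zero} (((B , _ , ∣B∣≡1) , _) , bound′ , bound″)
    with x , _ ← ∣p∣>0⇒nonempty {p = B} (≤-reflexive (sym (+-injective ∣B∣≡1)))
    with ℤ.+≤+ () ← sideBounds⇒1≤α {G = G} bound′ bound″ x
  splitIndepBound {α = ℤ.+ suc a} ((_ , whole) , bound′ , bound″) = a , refl , record
    { whole = λ B indep → subst (∣ B ∣ ≤_) (+-comm (suc a) 1) (drop‿+≤+ (whole B indep))
    ; in-V′ = λ B B⊆V′ indep → drop‿+≤+ (bound′ B B⊆V′ indep)
    ; in-V″ = λ B B⊆V″ indep → drop‿+≤+ (bound″ B B⊆V″ indep)
    }

  -- The circular construction

  module CircularIndependence (k : ℕ) (n : Fin (2 + k) → ℕ)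
                              (G : (i : Fin (2 + k)) → FourGraph (n i))
                              (V′ : (i : Fin (2 + k)) → Subset (n i)) where

    open Circular (2 + k) n G V′

    hit-self : ∀ i (x′ : Fin (n i)) y x → hit (i , x′ , y) i x ≡ isYes (x′ ≟ x)
    hit-self i x′ y x with i ≟ i
    ... | yes refl = refl
    ... | no  i≢i  = contradiction refl i≢i

    hit-next : ∀ i v y (x : Fin (n i)) → hit (next i , v , y) i x ≡ false
    hit-next i v y x with next i ≟ i
    ... | yes next≡i = contradiction next≡i (next≢id i)
    ... | no  _      = refl

    H-functional : ∀ {i w v v′} → H i w v → H i w v′ → v ≡ v′
    H-functional     (inj₁ (_ , refl)) (inj₁ (_ , refl)) = refl
    H-functional {i} (inj₁ (_ , refl)) (inj₂ (_ , eq))   = ⊥-elim (next≢id i (sym (cong proj₁ eq)))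
    H-functional {i} (inj₂ (_ , refl)) (inj₁ (_ , eq))   = ⊥-elim (next≢id i (cong proj₁ eq))
    H-functional     (inj₂ (_ , refl)) (inj₂ (_ , refl)) = refl

    vertex-≢ˣ : ∀ {i x x′ y y′} → x ≢ x′ → _≢_ {A = Vtx} (i , x , y) (i , x′ , y′)
    vertex-≢ˣ x≢x′ refl = x≢x′ refl

    vertex-≢ʸ : ∀ {i x y y′} → y ≢ y′ → _≢_ {A = Vtx} (i , x , y) (i , x , y′)
    vertex-≢ʸ y≢y′ refl = y≢y′ refl

    χ≡+sgn : ∀ A i → χ A i ≡ ℤ.+ sgn (sizeW A i)
    χ≡+sgn A i with sizeW A i
    ... | zero  = refl
    ... | suc _ = refl

    sumℤ-α-1+χ : ∀ A (α : Fin (2 + k) → ℤ) (a : Fin (2 + k) → ℕ) → (∀ i → α i ≡ ℤ.+ suc (a i)) →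
      sumℤ (λ i → α i ℤ.- ℤ.+ 1 ℤ.+ χ A i) ≡ ℤ.+ sumℕ (λ i → a i + sgn (sizeW A i))
    sumℤ-α-1+χ A α a α≡1+a =
      sumℤ≡+sumℕ _ λ i → cong₂ (λ α′ χ′ → α′ ℤ.- ℤ.+ 1 ℤ.+ χ′) (α≡1+a i) (χ≡+sgn A i)

    module _ (A : VSet) (A⊆W : InUnionW A) (A-indep : IndependentC A) where

      -- X i is the set of columns W_{i,x} met by A; its size is β_i(A).
      X : (i : Fin (2 + k)) → Subset (n i)
      X i = tabulate (λ x → 0 <ᵇ ∣ A i x ∣)

      ∈X⇒nonempty : ∀ {i x} → x ∈ X i → Nonempty (A i x)
      ∈X⇒nonempty x∈X = ∣p∣>0⇒nonempty (<ᵇ⇒< 0 _ (∈tabulate⇒T x∈X))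

      X⊆V′ : ∀ i → X i ⊆ V′ i
      X⊆V′ i {x} x∈X = let y , y∈A = ∈X⇒nonempty x∈X in proj₁ (A⊆W i x y y∈A)

      -- via the edges E⁴
      X-spansNoEdge : ∀ i → SpansNoEdge (G i) (X i)
      X-spansNoEdge i {x₁} {x₂} {x₃} {x₄} x₁∈X x₂∈X x₃∈X x₄∈X
        (distinct₄ d₁₂ d₁₃ d₁₄ d₂₃ d₂₄ d₃₄) edge =
        let y₁ , y₁∈ = ∈X⇒nonempty x₁∈X
            y₂ , y₂∈ = ∈X⇒nonempty x₂∈X
            y₃ , y₃∈ = ∈X⇒nonempty x₃∈X
            y₄ , y₄∈ = ∈X⇒nonempty x₄∈X
        in proj₂ (proj₂ (A-indep (i , x₁ , y₁) (i , x₂ , y₂) (i , x₃ , y₃) (i , x₄ , y₄)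
                   y₁∈ y₂∈ y₃∈ y₄∈ (vertex-≢ˣ d₁₂) (vertex-≢ˣ d₁₃) (vertex-≢ˣ d₁₄)
                   (vertex-≢ˣ d₂₃) (vertex-≢ˣ d₂₄) (vertex-≢ˣ d₃₄) i))
             (_ , _ , _ , _ , _ , _ , _ , _ , refl , refl , refl , refl ,
              d₁₂ , d₁₃ , d₁₄ , d₂₃ , d₂₄ , d₃₄ , edge)

      -- via the edges E²
      heavy-column-unique : ∀ i {x x′} → x ≢ x′ → 1 < ∣ A i x ∣ → ∣ A i x′ ∣ ≤ 1
      heavy-column-unique i {x} {x′} x≢x′ 1<∣Aᵢₓ∣ = ≮⇒≥ λ 1<∣Aᵢₓ′∣ →
        let y₁ , y₁∈ = ∣p∣>0⇒nonempty (<-trans z<s 1<∣Aᵢₓ∣)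
            y₂ , y₂∈ , y₂≢y₁ = ∣p∣>1⇒∃≢ 1<∣Aᵢₓ∣ y₁
            y₃ , y₃∈ = ∣p∣>0⇒nonempty (<-trans z<s 1<∣Aᵢₓ′∣)
            y₄ , y₄∈ , y₄≢y₃ = ∣p∣>1⇒∃≢ 1<∣Aᵢₓ′∣ y₃
        in proj₁ (proj₂ (A-indep (i , x , y₁) (i , x , y₂) (i , x′ , y₃) (i , x′ , y₄)
                   y₁∈ y₂∈ y₃∈ y₄∈ (vertex-≢ʸ (≢-sym y₂≢y₁)) (vertex-≢ˣ x≢x′) (vertex-≢ˣ x≢x′)
                   (vertex-≢ˣ x≢x′) (vertex-≢ˣ x≢x′) (vertex-≢ʸ (≢-sym y₄≢y₃)) i))
             (_ , _ , _ , _ , _ , _ , _ , _ , refl , refl , refl , refl , refl , refl , ≢-sym x≢x′)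

      -- A vertex of A lying over v (under h_i) and meeting no column of W_i other than c: either
      -- (c , v) itself, or (v , y) ∈ W_{i+1}.  Four of them therefore have β_i = 1.
      record Representative (i : Fin (2 + k)) (c : Fin (n i)) (v : Fin (n (next i))) : Set where
        field
          vertex      : Vtx
          vertex∈A    : vertex ∈A A
          image       : H i vertex v
          hits-only-c : ∀ x → T (hit vertex i x) → x ≡ c
          hits-c      : v ∈ A i c → T (hit vertex i c)

      representative : ∀ i c v → v ∈ A i c ∪ X (next i) → Representative i c v
      representative i c v v∈ with v ∈? A i c | x∈p∪q⁻ (A i c) (X (next i)) v∈
      ... | yes v∈Aᵢc | _ = record
        { vertex      = i , c , v
        ; vertex∈A    = v∈Aᵢc
        ; image       = inj₁ (c , refl)
        ; hits-only-c = λ x hit → sym (toWitness (subst T (hit-self i c v x) hit))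
        ; hits-c      = λ _ → subst T (sym (hit-self i c v c)) (fromWitness refl)
        }
      ... | no v∉Aᵢc | inj₁ v∈Aᵢc = contradiction v∈Aᵢc v∉Aᵢc
      ... | no v∉Aᵢc | inj₂ v∈X   = let y , y∈ = ∈X⇒nonempty v∈X in record
        { vertex      = next i , v , y
        ; vertex∈A    = y∈
        ; image       = inj₂ (y , refl)
        ; hits-only-c = λ x hit → ⊥-elim (subst T (hit-next i v y x) hit)
        ; hits-c      = λ v∈Aᵢc → contradiction v∈Aᵢc v∉Aᵢc
        }

      -- via the edges E¹, or E⁴ when no vertex lies in A i c
      A∪X-independent : ∀ i c → Independent (G (next i)) (A i c ∪ X (next i))
      A∪X-independent i c = spansNoEdge⇒independent {G = G (next i)} noEdge
        where
        noEdge : SpansNoEdge (G (next i)) (A i c ∪ X (next i))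
        noEdge {v₁} {v₂} {v₃} {v₄} v₁∈ v₂∈ v₃∈ v₄∈ distinct edge
          with Any.any? (_∈? A i c) (v₁ ∷ v₂ ∷ v₃ ∷ v₄ ∷ [])
        ... | no none = X-spansNoEdge (next i)
          (in-X v₁∈ (none ∘ Any.here)) (in-X v₂∈ (none ∘ Any.there ∘ Any.here))
          (in-X v₃∈ (none ∘ Any.there ∘ Any.there ∘ Any.here))
          (in-X v₄∈ (none ∘ Any.there ∘ Any.there ∘ Any.there ∘ Any.here))
          distinct edge
          where
          in-X : ∀ {v} → v ∈ A i c ∪ X (next i) → v ∉ A i c → v ∈ X (next i)
          in-X v∈ v∉Aᵢc with x∈p∪q⁻ (A i c) (X (next i)) v∈
          ... | inj₁ v∈Aᵢc = contradiction v∈Aᵢc v∉Aᵢc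
          ... | inj₂ v∈X   = v∈X
        ... | yes some =
          let distinct₄ e₁₂ e₁₃ e₁₄ e₂₃ e₂₄ e₃₄ = Distinct₄-reflect (H i) H-functional
                (image R₁) (image R₂) (image R₃) (image R₄) distinct
          in proj₁ (A-indep w₁ w₂ w₃ w₄ (vertex∈A R₁) (vertex∈A R₂) (vertex∈A R₃) (vertex∈A R₄)
                      e₁₂ e₁₃ e₁₄ e₂₃ e₂₄ e₃₄ i)
               (β≡1 , v₁ , v₂ , v₃ , v₄ , image R₁ , image R₂ , image R₃ , image R₄ , edge)
          where
          open Representative
          R₁ = representative i c v₁ v₁∈
          R₂ = representative i c v₂ v₂∈
          R₃ = representative i c v₃ v₃∈
          R₄ = representative i c v₄ v₄∈
          w₁ = vertex R₁
          w₂ = vertex R₂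
          w₃ = vertex R₃
          w₄ = vertex R₄
          hits : Any (_∈ A i c) (v₁ ∷ v₂ ∷ v₃ ∷ v₄ ∷ []) →
                 Any (λ w → T (hit w i c)) (w₁ ∷ w₂ ∷ w₃ ∷ w₄ ∷ [])
          hits (here v∈)                         = here (hits-c R₁ v∈)
          hits (there (here v∈))                 = there (here (hits-c R₂ v∈))
          hits (there (there (here v∈)))         = there (there (here (hits-c R₃ v∈)))
          hits (there (there (there (here v∈)))) = there (there (there (here (hits-c R₄ v∈))))
          β≡1 : β i w₁ w₂ w₃ w₄ ≡ 1
          β≡1 = ∣tabulate-any∣≡1 (λ w x → hit w i x) (w₁ ∷ w₂ ∷ w₃ ∷ w₄ ∷ []) c
            (hits-only-c R₁ ∷ hits-only-c R₂ ∷ hits-only-c R₃ ∷ hits-only-c R₄ ∷ [])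
            (hits some)

      ∣X∣≡sum-sgn : ∀ i → ∣ X i ∣ ≡ sum (λ x → sgn ∣ A i x ∣)
      ∣X∣≡sum-sgn i = ∣tabulate-0<ᵇ∣ (λ x → ∣ A i x ∣)

      sizeW≡sum : ∀ i → sizeW A i ≡ sum (λ x → ∣ A i x ∣)
      sizeW≡sum i = sumℕ≡sum (λ x → ∣ A i x ∣)

      ∣X∣≤sizeW : ∀ i → ∣ X i ∣ ≤ sizeW A i
      ∣X∣≤sizeW i = subst₂ _≤_ (sym (∣X∣≡sum-sgn i)) (sym (sizeW≡sum i))
        (sum-mono-≤ (λ x → sgn≤id ∣ A i x ∣))

      heavy-column : ∀ i → 0 < sizeW A i → ∃[ c ] 0 < ∣ A i c ∣ × (∀ x → x ≢ c → ∣ A i x ∣ ≤ 1)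
      heavy-column i 0<size with any? (λ x → 1 <? ∣ A i x ∣)
      ... | yes (c , 1<∣Aᵢc∣) =
        c , <-trans z<s 1<∣Aᵢc∣ , λ x x≢c → heavy-column-unique i (≢-sym x≢c) 1<∣Aᵢc∣
      ... | no  none =
        let c , 0<∣Aᵢc∣ = sum-positive (λ x → ∣ A i x ∣) (subst (0 <_) (sizeW≡sum i) 0<size)
        in c , 0<∣Aᵢc∣ , λ x _ → ≮⇒≥ (λ 1<∣Aᵢₓ∣ → none (x , 1<∣Aᵢₓ∣))

      sizeW≤∣X∣+pred : ∀ i c → (∀ x → x ≢ c → ∣ A i x ∣ ≤ 1) → sizeW A i ≤ ∣ X i ∣ + pred ∣ A i c ∣
      sizeW≤∣X∣+pred i c light =
        subst₂ (λ s b → s ≤ b + pred ∣ A i c ∣) (sym (sizeW≡sum i)) (sym (∣X∣≡sum-sgn i))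
          (sum-≤-sum-sgn+pred (λ x → ∣ A i x ∣) c light)

      module _ (a : Fin (2 + k) → ℕ) (bound : ∀ i → SplitIndepBound (G i) (V′ i) (a i)) where

        open SplitIndepBound

        ∣X∣≤a+χ : ∀ j → ∣ X j ∣ ≤ a j + sgn (sizeW A j)
        ∣X∣≤a+χ j with sizeW A j in size≡
        ... | zero  = ≤-trans (≤-trans (∣X∣≤sizeW j) (≤-reflexive size≡)) z≤n
        ... | suc _ = subst (∣ X j ∣ ≤_) (+-comm 1 (a j)) (in-V′ (bound j) (X j) (X⊆V′ j)
                        (spansNoEdge⇒independent {G = G j} (X-spansNoEdge j)))

        ∣Aᵢc∣+∣X∣≤1+a+χ : ∀ i c →
          ∣ A i c ∣ + ∣ X (next i) ∣ ≤ suc (a (next i) + sgn (sizeW A (next i)))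
        ∣Aᵢc∣+∣X∣≤1+a+χ i c with sizeW A (next i) in size≡
        ... | zero  = +-mono-≤
          (in-V″ (bound (next i)) (A i c) Aᵢc⊆V″
            (⊆-independent {G = G (next i)} (p⊆p∪q _) (A∪X-independent i c)))
          (≤-trans (∣X∣≤sizeW (next i)) (≤-reflexive size≡))
          where
          Aᵢc⊆V″ : A i c ⊆ ∁ (V′ (next i))
          Aᵢc⊆V″ {y} y∈ = x∉p⇒x∈∁p (proj₂ (A⊆W i c y y∈))
        ... | suc _ =
          subst₂ _≤_ (∣p∪q∣≡∣p∣+∣q∣ (A i c) (X (next i)) disjoint) (cong suc (+-comm 1 (a (next i))))
            (whole (bound (next i)) _ (A∪X-independent i c))
          where
          disjoint : ∀ {y} → y ∈ A i c → y ∉ X (next i)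
          disjoint {y} y∈ = proj₂ (A⊆W i c y y∈) ∘ X⊆V′ (next i)

        cyclic-step : ∀ i →
          sizeW A i + ∣ X (next i) ∣ ≤ (a (next i) + sgn (sizeW A (next i))) + ∣ X i ∣
        cyclic-step i with 0 <? sizeW A i
        ... | no  size≯0 =
          ≤-trans (+-monoˡ-≤ _ (≮⇒≥ size≯0)) (≤-trans (∣X∣≤a+χ (next i)) (m≤m+n _ _))
        ... | yes 0<size with c , 0<∣Aᵢc∣ , light ← heavy-column i 0<size = begin
          sizeW A i + ∣ X (next i) ∣
            ≤⟨ +-monoˡ-≤ _ (sizeW≤∣X∣+pred i c light) ⟩
          (∣ X i ∣ + pred ∣ A i c ∣) + ∣ X (next i) ∣
            ≡⟨ +-assoc ∣ X i ∣ _ _ ⟩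
          ∣ X i ∣ + (pred ∣ A i c ∣ + ∣ X (next i) ∣)
            ≤⟨ +-monoʳ-≤ ∣ X i ∣ (pred-step 0<∣Aᵢc∣ (∣Aᵢc∣+∣X∣≤1+a+χ i c)) ⟩
          ∣ X i ∣ + (a (next i) + sgn (sizeW A (next i)))
            ≡⟨ +-comm ∣ X i ∣ _ ⟩
          (a (next i) + sgn (sizeW A (next i))) + ∣ X i ∣
            ∎
          where
          open ≤-Reasoning
          pred-step : ∀ {d b t} → 0 < d → d + b ≤ suc t → pred d + b ≤ t
          pred-step {suc d} _ (s≤s d+b≤t) = d+b≤t

        size≤∑a+χ : size A ≤ sumℕ (λ i → a i + sgn (sizeW A i))
        size≤∑a+χ = begin
          size A                             ≡⟨ sumℕ≡sum (sizeW A) ⟩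
          sum (sizeW A)                      ≤⟨ sum-≤-by-cyclic-step (sizeW A) a+χ (λ i → ∣ X i ∣) cyclic-step ⟩
          sum a+χ                            ≡⟨ sumℕ≡sum a+χ ⟨
          sumℕ (λ i → a i + sgn (sizeW A i)) ∎
          where
          open ≤-Reasoning
          a+χ : Fin (2 + k) → ℕ
          a+χ i = a i + sgn (sizeW A i)

open import Data.Nat using (ℕ; _≤_; suc; s≤s; z≤n)
open import Data.Fin using (Fin)
open import Data.Fin.Subset using (Subset; ∁)
open import Data.Integer as ℤ using (ℤ; +_; _+_; _-_)
open import Data.Product using (_×_; proj₁; proj₂)
open import Relation.Binary.PropositionalEquality using (_≡_; subst; sym)
open import Function using (_∘_)
open Counting using (SplitIndepBound; splitIndepBound; module CircularIndependence)

theorem2 : (m : ℕ) → 2 ≤ m →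
    (n : Fin m → ℕ) (G : (i : Fin m) → FourGraph (n i))
    (V′ : (i : Fin m) → Subset (n i)) (α : Fin m → ℤ) →
    (∀ i → IndepNumberIs (G i) (α i + + 1) ×
           InducedIndepAtMost (G i) (V′ i) (α i) ×
           InducedIndepAtMost (G i) (∁ (V′ i)) (α i)) →
    (A : Circular.VSet m n G V′) →
    Circular.InUnionW m n G V′ A →
    Circular.IndependentC m n G V′ A →
    + Circular.size m n G V′ A ℤ.≤ sumℤ (λ i → α i - + 1 + Circular.χ m n G V′ A i)
theorem2 (suc (suc k)) (s≤s (s≤s z≤n)) n G V′ α hyp A A⊆W A-indep =
  subst (+ size A ℤ.≤_) (sym (sumℤ-α-1+χ A α a (proj₁ ∘ α≡1+a∧bound)))
    (ℤ.+≤+ (size≤∑a+χ A A⊆W A-indep a (proj₂ ∘ α≡1+a∧bound)))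
  where
  open Circular (suc (suc k)) n G V′
  open CircularIndependence k n G V′
  a : Fin (suc (suc k)) → ℕ
  a i = proj₁ (splitIndepBound (hyp i))
  α≡1+a∧bound : ∀ i → α i ≡ + suc (a i) × SplitIndepBound (G i) (V′ i) (a i)
  α≡1+a∧bound i = proj₂ (splitIndepBound (hyp i))
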